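{- Fix a tabular quasi-normal modal logic $L=\mathrm{Log}(\mathcal F_L)$ with $\mathcal F_L$ a finite set of finite frames each rooted at $0$, and a signature $\sigma$. Let $\mathfrak M,0$ be any pointed model based on a frame in $\mathcal F_L$, let $\mathfrak F\in\mathcal F_L$ and $\xi\in\mathrm{PL}(\sigma_{\mathfrak F})$. Then the following are equivalent: (1) $\mathfrak M,0\models\mathit{rt}_{\mathfrak F,L}(\xi)$; (2) there is a model $\mathfrak M'$ based on $\mathfrak F$ with $\mathfrak M,0\sim_\sigma\mathfrak M',0$ and $v_{\mathfrak M'}\models\xi$.
   Context: Let $N=\max\{|\mathfrak F'|:\mathfrak F'\in\mathcal F_L\}$; $\Box^{\le N}\varphi=\varphi\wedge\Box\varphi\wedge\dots\wedge\Box^N\varphi$, $\Diamond^{\le N}=\neg\Box^{\le N}\neg$. For $\mathfrak F=(W,R)$, $\sigma_{\mathfrak F}=\{p_w:p\in\sigma,w\in W\}$, and for a model $\mathfrak M'$ on $\mathfrak F$, $v_{\mathfrak M'}(p_w)=1$ iff $\mathfrak M',w\models p$. A $\sigma$-bisimulation: relation preserving atoms of $\sigma$ with Forth and Back; $\sim_\sigma$ = related by one. A $\sigma$-EME is a finite set $\Phi$ of propositional formulas over $\sigma$ whose disjunction is a tautology and whose members are pairwise inconsistent; it is a $\sigma$-cover of $\mathfrak M$ if worlds satisfying the same $\phi\in\Phi$ agree on $\sigma$. $\mathit{cover}(\sigma,\Phi)=\bigwedge_{\phi\in\Phi}\bigwedge_{p\in\sigma}(\Diamond^{\le N}(\phi\wedge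 p)\to\Box^{\le N}(\phi\to p))$. Abstract $\Phi$-model: $(\mathfrak G,f)$ with $f$ mapping worlds to $\Phi$; for $L$ if $\mathfrak G\in\mathcal F_L$. Abstract $\Phi$-bisimulation: Forth, Back, and related worlds have equal $f$-values. Modal formulas over $\Phi$ (members of $\Phi$ as atoms, $\mathfrak A,w\models\phi$ iff $f(w)=\phi$). For an abstract $\Phi$-model $\mathfrak A$ for $L$, $[\mathfrak A]_L$ = abstract $\Phi$-models for $L$ abstractly $\Phi$-bisimilar to it at the roots; an abstract class identifier for $[\mathfrak A]_L$ is a formula $\delta$ over $\Phi$ true at the root of exactly the members of $[\mathfrak A]_L$ among abstract $\Phi$-models for $L$; write $[\delta]_L$ for this class. A $\sigma$-encoding for $L$ is $(\Gamma,\{\Delta_\Phi\}_{\Phi\in\Gamma})$, $\Gamma$ a set of $\sigma$-EMEs and $\Delta_\Phi$ a set of abstract class identifiers, such that every model $\mathfrak M$ on a frame of $\mathcal F_L$ has some $\Phi\in\Gamma$ that is a $\sigma$-cover of $\mathfrak M$ and some $\delta\in\Delta_\Phi$ with $\mathfrak M,0\models\delta$. Fix a $\sigma$-encoding $(\Gamma,\{\Delta_\Phi\})$ for $L$ (the paper uses one computed in polynomial time). Define $\mathit{rt}_{\mathfrak F,L}(\xi)=\bigwedge_{\Phi\in\Gamma}\bigwedge_{\delta\in\Delta_\Phi}\big((\mathit{cover}(\sigma,\Phi)\wedge\delta)\to\bigvee_{(\mathfrak F,f)\in[\delta]_L}\xi^f\big)$, where the disjunction ranges over the members of $[\delta]_L$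 based on the frame $\mathfrak F$, and $\xi^f$ results from $\xi$ by replacing each $p_w$ by $\Diamond^{\le N}(f(w)\wedge p)$. Tabular quasi-normal logic: $\mathrm{Log}$ (validity at the root) of a finite set of finite pointed frames. -}

module Defs where

open import Data.Nat using (ℕ; zero; suc; _⊔_)
open import Data.Fin using (Fin; zero; suc; _≟_)
open import Data.Bool using (Bool; true; false; _∧_; _∨_; not; if_then_else_)
open import Data.List using (List; []; _∷_; foldr; map; concatMap; allFin; length; lookup)
open import Data.List.Membership.Propositional using (_∈_)
open import Data.List.Relation.Unary.All using (All)
open import Data.List.Relation.Unary.Any using (Any)
open import Data.List.Relation.Unary.Unique.Propositional using (Unique)
open import Data.Product using (Σ; ∃; _×_; _,_; proj₁; proj₂)
open import Relation.Nullary using (¬_; does)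
open import Relation.Binary.PropositionalEquality using (_≡_; _≢_)
open import Relation.Binary.Construct.Closure.ReflexiveTransitive using (Star)
open import Function.Bundles using (_⇔_)

record Frame : Set where
  constructor frame
  field
    n : ℕ
    R : Fin (suc n) → Fin (suc n) → Bool

World : Frame → Set
World F = Fin (suc (Frame.n F))

Acc : (F : Frame) → World F → World F → Set
Acc F w v = Frame.R F w v ≡ true

size : Frame → ℕ
size F = suc (Frame.n F)

Rooted : Frame → Set
Rooted F = ∀ (w : World F) → Star (Acc F) zero w

data PL (A : Set) : Set where
  atom : A → PL A
  ⊥ₚ   : PL A
  ¬ₚ_  : PL A → PL A
  _∧ₚ_ : PL A → PL A → PL A
  _∨ₚ_ : PL A → PL A → PL A
  _⇒ₚ_ : PL A → PL A → PL A

evalPL : {A : Set} → (A → Bool) → PL A → Bool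
evalPL v (atom a) = v a
evalPL v ⊥ₚ = false
evalPL v (¬ₚ φ) = not (evalPL v φ)
evalPL v (φ ∧ₚ ψ) = evalPL v φ ∧ evalPL v ψ
evalPL v (φ ∨ₚ ψ) = evalPL v φ ∨ evalPL v ψ
evalPL v (φ ⇒ₚ ψ) = not (evalPL v φ) ∨ evalPL v ψ

AtomsPL : {A : Set} → (A → Set) → PL A → Set
AtomsPL P (atom a) = P a
AtomsPL P ⊥ₚ = Data.Unit.⊤ where import Data.Unit
AtomsPL P (¬ₚ φ) = AtomsPL P φ
AtomsPL P (φ ∧ₚ ψ) = AtomsPL P φ × AtomsPL P ψ
AtomsPL P (φ ∨ₚ ψ) = AtomsPL P φ × AtomsPL P ψ
AtomsPL P (φ ⇒ₚ ψ) = AtomsPL P φ × AtomsPL P ψ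

data Fm (A : Set) : Set where
  atom : A → Fm A
  ⊥ₘ   : Fm A
  ¬ₘ_  : Fm A → Fm A
  _∧ₘ_ : Fm A → Fm A → Fm A
  _∨ₘ_ : Fm A → Fm A → Fm A
  _⇒ₘ_ : Fm A → Fm A → Fm A
  □_   : Fm A → Fm A

⊤ₘ : {A : Set} → Fm A
⊤ₘ = ¬ₘ ⊥ₘ

◇_ : {A : Set} → Fm A → Fm A
◇ φ = ¬ₘ (□ (¬ₘ φ))

embPL : {A : Set} → PL A → Fm A
embPL (atom a) = atom a
embPL ⊥ₚ = ⊥ₘ
embPL (¬ₚ φ) = ¬ₘ embPL φ
embPL (φ ∧ₚ ψ) = embPL φ ∧ₘ embPL ψ
embPL (φ ∨ₚ ψ) = embPL φ ∨ₘ embPL ψ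
embPL (φ ⇒ₚ ψ) = embPL φ ⇒ₘ embPL ψ

substFm : {A B : Set} → (A → Fm B) → Fm A → Fm B
substFm s (atom a) = s a
substFm s ⊥ₘ = ⊥ₘ
substFm s (¬ₘ φ) = ¬ₘ substFm s φ
substFm s (φ ∧ₘ ψ) = substFm s φ ∧ₘ substFm s ψ
substFm s (φ ∨ₘ ψ) = substFm s φ ∨ₘ substFm s ψ
substFm s (φ ⇒ₘ ψ) = substFm s φ ⇒ₘ substFm s ψ
substFm s (□ φ) = □ substFm s φ

substPL : {A B : Set} → (A → Fm B) → PL A → Fm B
substPL s φ = substFm s (embPL φ)

⋀ : {A : Set} → List (Fm A) → Fm A
⋀ = foldr _∧ₘ_ ⊤ₘ

⋁ : {A : Set} → List (Fm A) → Fm A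
⋁ = foldr _∨ₘ_ ⊥ₘ

□^ : {A : Set} → ℕ → Fm A → Fm A
□^ zero φ = φ
□^ (suc k) φ = □ (□^ k φ)

□≤ : {A : Set} → ℕ → Fm A → Fm A
□≤ zero φ = φ
□≤ (suc k) φ = □≤ k φ ∧ₘ □^ (suc k) φ

◇≤ : {A : Set} → ℕ → Fm A → Fm A
◇≤ k φ = ¬ₘ (□≤ k (¬ₘ φ))

allB : {A : Set} → (A → Bool) → List A → Bool
allB P = foldr (λ x b → P x ∧ b) true

sat : {A : Set} (F : Frame) → (A → World F → Bool) → World F → Fm A → Bool
sat F V w (atom a) = V a w
sat F V w ⊥ₘ = false
sat F V w (¬ₘ φ) = not (sat F V w φ)
sat F V w (φ ∧ₘ ψ) = sat F V w φ ∧ sat F V w ψ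
sat F V w (φ ∨ₘ ψ) = sat F V w φ ∨ sat F V w ψ
sat F V w (φ ⇒ₘ ψ) = not (sat F V w φ) ∨ sat F V w ψ
sat F V w (□ φ) = allB (λ u → not (Frame.R F w u) ∨ sat F V u φ) (allFin (size F))

Valuation : Frame → Set
Valuation F = ℕ → World F → Bool

record IsBisim (σ : List ℕ) (F : Frame) (V : Valuation F) (F' : Frame) (V' : Valuation F')
               (Z : World F → World F' → Set) : Set where
  field
    atoms : ∀ {w w'} → Z w w' → ∀ {p} → p ∈ σ → V p w ≡ V' p w'
    forth : ∀ {w w' v} → Z w w' → Acc F w v → ∃ λ v' → Acc F' w' v' × Z v v'
    back  : ∀ {w w' v'} → Z w w' → Acc F' w' v' → ∃ λ v → Acc F w v × Z v v'

Bisim₀ : (σ : List ℕ) (F : Frame) (V : Valuation F) (F' : Frame) (V' : Valuation F') → Set₁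
Bisim₀ σ F V F' V' = Σ (World F → World F' → Set) λ Z → IsBisim σ F V F' V' Z × Z zero zero

-- Exhaustive mutually exclusive sets (EMEs), as lists without duplicates

IsEME : List ℕ → List (PL ℕ) → Set
IsEME σ Φ =
  All (AtomsPL (_∈ σ)) Φ
  × Unique Φ
  × (∀ (v : ℕ → Bool) → Any (λ φ → evalPL v φ ≡ true) Φ)
  × (∀ (i j : Fin (length Φ)) → i ≢ j → ∀ (v : ℕ → Bool) →
       evalPL v (lookup Φ i) ≡ true → evalPL v (lookup Φ j) ≡ false)

IsCover : (σ : List ℕ) → List (PL ℕ) → (F : Frame) → Valuation F → Set
IsCover σ Φ F V =
  ∀ (φ : PL ℕ) → φ ∈ Φ → ∀ (w u : World F) →
    evalPL (λ p → V p w) φ ≡ true → evalPL (λ p → V p u) φ ≡ true →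
    ∀ {p} → p ∈ σ → V p w ≡ V p u

-- Abstract Φ-models: a frame together with  f : worlds → Φ
-- (members of Φ are referred to by their index in the list Φ)

record AbsModel (k : ℕ) : Set where
  constructor absModel
  field
    frm : Frame
    lab : World frm → Fin k

absVal : {k : ℕ} (F : Frame) → (World F → Fin k) → Fin k → World F → Bool
absVal F f i w = does (f w ≟ i)

satAbs : {k : ℕ} → AbsModel k → Fm (Fin k) → Bool
satAbs (absModel F f) δ = sat F (absVal F f) zero δ

AbsBisim₀ : {k : ℕ} → AbsModel k → AbsModel k → Set₁
AbsBisim₀ (absModel F f) (absModel G g) =
  Σ (World F → World G → Set) λ Z →
    (∀ {w w'} → Z w w' → f w ≡ g w')
    × (∀ {w w' v} → Z w w' → Acc F w v → ∃ λ v' → Acc G w' v' × Z v v')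
    × (∀ {w w' v'} → Z w w' → Acc G w' v' → ∃ λ v → Acc F w v × Z v v')
    × Z zero zero

IsClassId : (FL : List Frame) {k : ℕ} → Fm (Fin k) → Set₁
IsClassId FL {k} δ =
  Σ (AbsModel k) λ 𝔄 → (AbsModel.frm 𝔄 ∈ FL) ×
    (∀ (𝔅 : AbsModel k) → AbsModel.frm 𝔅 ∈ FL → (satAbs 𝔅 δ ≡ true ⇔ AbsBisim₀ 𝔄 𝔅))

Encoding : Set
Encoding = List (Σ (List (PL ℕ)) λ Φ → List (Fm (Fin (length Φ))))

toFm : (Φ : List (PL ℕ)) → Fm (Fin (length Φ)) → Fm ℕ
toFm Φ δ = substFm (λ i → embPL (lookup Φ i)) δ

IsEncoding : (FL : List Frame) (σ : List ℕ) → Encoding → Set₁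
IsEncoding FL σ enc =
  All (λ ΦΔ → IsEME σ (proj₁ ΦΔ) × All (IsClassId FL) (proj₂ ΦΔ)) enc
  × (∀ (F : Frame) → F ∈ FL → ∀ (V : Valuation F) →
       Any (λ ΦΔ → IsCover σ (proj₁ ΦΔ) F V ×
                   Any (λ δ → sat F V zero (toFm (proj₁ ΦΔ) δ) ≡ true) (proj₂ ΦΔ)) enc)

maxSize : List Frame → ℕ
maxSize = foldr (λ F m → size F ⊔ m) 0

cover : ℕ → List ℕ → List (PL ℕ) → Fm ℕ
cover N σ Φ =
  ⋀ (map (λ φ → ⋀ (map (λ p → ◇≤ N (embPL φ ∧ₘ atom p) ⇒ₘ □≤ N (embPL φ ⇒ₘ atom p)) σ)) Φ)

allFuns : (n k : ℕ) → List (Fin n → Fin k)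
allFuns zero k = (λ ()) ∷ []
allFuns (suc n) k =
  concatMap (λ i → map (λ f → λ { zero → i ; (suc x) → f x }) (allFuns n k)) (allFin k)

boolFilter : {A : Set} → (A → Bool) → List A → List A
boolFilter P = foldr (λ x xs → if P x then x ∷ xs else xs) []

xiF : ℕ → (Φ : List (PL ℕ)) (F : Frame) → (World F → Fin (length Φ)) →
      PL (ℕ × World F) → Fm ℕ
xiF N Φ F f ξ = substPL (λ pw → ◇≤ N (embPL (lookup Φ (f (proj₂ pw))) ∧ₘ atom (proj₁ pw))) ξ

rt : (FL : List Frame) (σ : List ℕ) (enc : Encoding) (F : Frame) → PL (ℕ × World F) → Fm ℕ
rt FL σ enc F ξ =
  ⋀ (concatMap (λ ΦΔ → map (λ δ →
        (cover N σ (proj₁ ΦΔ) ∧ₘ toFm (proj₁ ΦΔ) δ) ⇒ₘ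
        ⋁ (map (λ f → xiF N (proj₁ ΦΔ) F f ξ)
               (boolFilter (λ f → satAbs (absModel F f) δ)
                           (allFuns (size F) (length (proj₁ ΦΔ))))))
      (proj₂ ΦΔ)) enc)
  where N = maxSize FL

-- Let Φ be a σ-cover of 𝔐 and label each world w by the unique φ ∈ Φ true at w.
-- Every world of a frame in F_L lies within N steps of the root, so the σ-atoms
-- true at w are exactly the p with 𝔐,0 ⊨ ◇^{≤N}(φ ∧ p).  Hence, for a labelling f
-- of 𝔉, the formula ξ^f holds at 𝔐,0 iff ξ holds under the valuation V_f on 𝔉
-- given by  p true at w  iff  𝔐,0 ⊨ ◇^{≤N}(f(w) ∧ p), and any abstract
-- Φ-bisimulation between (𝔐, labels) and (𝔉, f) is a σ-bisimulation between 𝔐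
-- and (𝔉, V_f).  Conversely a σ-bisimulation between 𝔐 and (𝔉, V') is an abstract
-- Φ-bisimulation between their labellings, and V' agrees with V_f on σ for f the
-- labelling of V'.  Since the class identifier δ true at 𝔐 pins down the abstract
-- bisimilarity class of its labelling, both directions follow.
module Submission where

open import Defs
open import Data.Nat using (ℕ; zero; suc; _≤_; s≤s⁻¹)
open import Data.Nat.Properties using (≤-refl; ≤-trans; m≤n⇒m<n∨m≡n; m≤m⊔n; m≤n⇒m≤o⊔n; n≤1+n)
open import Data.Bool using (Bool; true; false; _∧_; _∨_; not)
open import Data.Fin using (Fin; zero; suc; _≟_)
open import Data.Fin.Properties using (injective⇒≤)
open import Data.List using (List; []; _∷_; map; allFin; length; lookup)
open import Data.List.Membership.Propositional using (_∈_; find; lose)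
open import Data.List.Membership.Propositional.Properties using (∈-allFin; ∈-lookup)
import Data.List.Membership.DecPropositional as DecMembership
open import Data.List.Relation.Unary.All as All using (All; []; _∷_)
import Data.List.Relation.Unary.All.Properties as AllP
open import Data.List.Relation.Unary.All.Properties.Core using (¬Any⇒All¬)
open import Data.List.Relation.Unary.Any as Any using (Any; here; there)
import Data.List.Relation.Unary.Any.Properties as AnyP
open import Data.List.Relation.Unary.AllPairs using ([]; _∷_)
open import Data.List.Relation.Unary.Unique.Propositional using (Unique)
open import Data.Product using (Σ; ∃; ∃₂; _×_; _,_; proj₁; proj₂)
open import Data.Sum using (_⊎_; inj₁; inj₂)
open import Data.Empty using (⊥-elim)
open import Function.Bundles using (_⇔_; mk⇔; Equivalence)
open import Relation.Nullary using (yes; no; does)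
open import Relation.Binary.PropositionalEquality using (_≡_; _≢_; refl; sym; trans; cong; cong₂; subst)
open import Relation.Binary.Construct.Closure.ReflexiveTransitive using (Star; ε; _◅_)

∧-true⁻ : ∀ {a b} → a ∧ b ≡ true → a ≡ true × b ≡ true
∧-true⁻ {true} {true} refl = refl , refl

∧-true⁺ : ∀ {a b} → a ≡ true → b ≡ true → a ∧ b ≡ true
∧-true⁺ refl refl = refl

∧-false⁻ : ∀ {a b} → a ∧ b ≡ false → a ≡ false ⊎ b ≡ false
∧-false⁻ {false} _ = inj₁ refl
∧-false⁻ {true} {false} _ = inj₂ refl

not-true⁻ : ∀ {a} → not a ≡ true → a ≡ false
not-true⁻ {false} _ = refl

not-false⁻ : ∀ {a} → not a ≡ false → a ≡ true
not-false⁻ {true} _ = refl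

imp-true⁻ : ∀ {a b} → not a ∨ b ≡ true → a ≡ true → b ≡ true
imp-true⁻ {true} h refl = h

imp-true⁺ : ∀ {a b} → (a ≡ true → b ≡ true) → not a ∨ b ≡ true
imp-true⁺ {false} _ = refl
imp-true⁺ {true} h = h refl

imp-false⁻ : ∀ {a b} → not a ∨ b ≡ false → a ≡ true × b ≡ false
imp-false⁻ {true} {false} _ = refl , refl

true⇔true⇒≡ : ∀ {a b} → (a ≡ true → b ≡ true) → (b ≡ true → a ≡ true) → a ≡ b
true⇔true⇒≡ {false} {false} _ _ = refl
true⇔true⇒≡ {false} {true} _ b⇒a = b⇒a refl
true⇔true⇒≡ {true} a⇒b _ = sym (a⇒b refl)

module _ {A : Set} {P : A → Bool} where

  allB-true⁻ : ∀ {xs x} → allB P xs ≡ true → x ∈ xs → P x ≡ true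
  allB-true⁻ {_ ∷ _} h (here refl) = proj₁ (∧-true⁻ h)
  allB-true⁻ {y ∷ _} h (there x∈) = allB-true⁻ (proj₂ (∧-true⁻ {P y} h)) x∈

  allB-true⁺ : ∀ {xs} → (∀ x → x ∈ xs → P x ≡ true) → allB P xs ≡ true
  allB-true⁺ {[]} _ = refl
  allB-true⁺ {y ∷ _} h = ∧-true⁺ (h y (here refl)) (allB-true⁺ λ x x∈ → h x (there x∈))

  allB-false⁻ : ∀ {xs} → allB P xs ≡ false → ∃ λ x → x ∈ xs × P x ≡ false
  allB-false⁻ {y ∷ _} h with ∧-false⁻ h
  ... | inj₁ Py = y , here refl , Py
  ... | inj₂ rest = let x , x∈ , Px = allB-false⁻ rest in x , there x∈ , Px

allB-cong : ∀ {A : Set} {P Q : A → Bool} (xs : List A) → (∀ x → P x ≡ Q x) → allB P xs ≡ allB Q xs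
allB-cong [] _ = refl
allB-cong (y ∷ ys) P≗Q = cong₂ _∧_ (P≗Q y) (allB-cong ys P≗Q)

evalPL-cong : ∀ {A : Set} {v₁ v₂ : A → Bool} φ → (∀ a → v₁ a ≡ v₂ a) → evalPL v₁ φ ≡ evalPL v₂ φ
evalPL-cong (atom a) v₁≗v₂ = v₁≗v₂ a
evalPL-cong ⊥ₚ _ = refl
evalPL-cong (¬ₚ φ) v₁≗v₂ = cong not (evalPL-cong φ v₁≗v₂)
evalPL-cong (φ ∧ₚ ψ) v₁≗v₂ = cong₂ _∧_ (evalPL-cong φ v₁≗v₂) (evalPL-cong ψ v₁≗v₂)
evalPL-cong (φ ∨ₚ ψ) v₁≗v₂ = cong₂ _∨_ (evalPL-cong φ v₁≗v₂) (evalPL-cong ψ v₁≗v₂)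
evalPL-cong (φ ⇒ₚ ψ) v₁≗v₂ = cong₂ (λ x y → not x ∨ y) (evalPL-cong φ v₁≗v₂) (evalPL-cong ψ v₁≗v₂)

evalPL-cong-on : ∀ {A : Set} {P : A → Set} {v₁ v₂ : A → Bool} φ → AtomsPL P φ →
                 (∀ a → P a → v₁ a ≡ v₂ a) → evalPL v₁ φ ≡ evalPL v₂ φ
evalPL-cong-on (atom a) Pa v₁≗v₂ = v₁≗v₂ a Pa
evalPL-cong-on ⊥ₚ _ _ = refl
evalPL-cong-on (¬ₚ φ) Pφ v₁≗v₂ = cong not (evalPL-cong-on φ Pφ v₁≗v₂)
evalPL-cong-on (φ ∧ₚ ψ) (Pφ , Pψ) v₁≗v₂ = cong₂ _∧_ (evalPL-cong-on φ Pφ v₁≗v₂) (evalPL-cong-on ψ Pψ v₁≗v₂)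
evalPL-cong-on (φ ∨ₚ ψ) (Pφ , Pψ) v₁≗v₂ = cong₂ _∨_ (evalPL-cong-on φ Pφ v₁≗v₂) (evalPL-cong-on ψ Pψ v₁≗v₂)
evalPL-cong-on (φ ⇒ₚ ψ) (Pφ , Pψ) v₁≗v₂ =
  cong₂ (λ x y → not x ∨ y) (evalPL-cong-on φ Pφ v₁≗v₂) (evalPL-cong-on ψ Pψ v₁≗v₂)

module _ {A : Set} (F : Frame) where

  sat-cong : {V₁ V₂ : A → World F → Bool} → (∀ a u → V₁ a u ≡ V₂ a u) →
             ∀ w φ → sat F V₁ w φ ≡ sat F V₂ w φ
  sat-cong V₁≗V₂ w (atom a) = V₁≗V₂ a w
  sat-cong V₁≗V₂ w ⊥ₘ = refl
  sat-cong V₁≗V₂ w (¬ₘ φ) = cong not (sat-cong V₁≗V₂ w φ)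
  sat-cong V₁≗V₂ w (φ ∧ₘ ψ) = cong₂ _∧_ (sat-cong V₁≗V₂ w φ) (sat-cong V₁≗V₂ w ψ)
  sat-cong V₁≗V₂ w (φ ∨ₘ ψ) = cong₂ _∨_ (sat-cong V₁≗V₂ w φ) (sat-cong V₁≗V₂ w ψ)
  sat-cong V₁≗V₂ w (φ ⇒ₘ ψ) = cong₂ (λ x y → not x ∨ y) (sat-cong V₁≗V₂ w φ) (sat-cong V₁≗V₂ w ψ)
  sat-cong V₁≗V₂ w (□ φ) =
    allB-cong (allFin (size F)) λ u → cong (λ x → not (Frame.R F w u) ∨ x) (sat-cong V₁≗V₂ u φ)

module _ {A B : Set} (F : Frame) where

  sat-substFm : (V : B → World F → Bool) (s : A → Fm B) →
                ∀ w φ → sat F V w (substFm s φ) ≡ sat F (λ a u → sat F V u (s a)) w φ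
  sat-substFm V s w (atom a) = refl
  sat-substFm V s w ⊥ₘ = refl
  sat-substFm V s w (¬ₘ φ) = cong not (sat-substFm V s w φ)
  sat-substFm V s w (φ ∧ₘ ψ) = cong₂ _∧_ (sat-substFm V s w φ) (sat-substFm V s w ψ)
  sat-substFm V s w (φ ∨ₘ ψ) = cong₂ _∨_ (sat-substFm V s w φ) (sat-substFm V s w ψ)
  sat-substFm V s w (φ ⇒ₘ ψ) = cong₂ (λ x y → not x ∨ y) (sat-substFm V s w φ) (sat-substFm V s w ψ)
  sat-substFm V s w (□ φ) =
    allB-cong (allFin (size F)) λ u → cong (λ x → not (Frame.R F w u) ∨ x) (sat-substFm V s u φ)

sat-embPL : ∀ {A : Set} (F : Frame) (V : A → World F → Bool) w φ →
            sat F V w (embPL φ) ≡ evalPL (λ a → V a w) φ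
sat-embPL F V w (atom a) = refl
sat-embPL F V w ⊥ₚ = refl
sat-embPL F V w (¬ₚ φ) = cong not (sat-embPL F V w φ)
sat-embPL F V w (φ ∧ₚ ψ) = cong₂ _∧_ (sat-embPL F V w φ) (sat-embPL F V w ψ)
sat-embPL F V w (φ ∨ₚ ψ) = cong₂ _∨_ (sat-embPL F V w φ) (sat-embPL F V w ψ)
sat-embPL F V w (φ ⇒ₚ ψ) = cong₂ (λ x y → not x ∨ y) (sat-embPL F V w φ) (sat-embPL F V w ψ)

data Path (F : Frame) : ℕ → World F → World F → Set where
  [] : ∀ {w} → Path F 0 w w
  _∷_ : ∀ {k w v u} → Acc F w v → Path F k v u → Path F (suc k) w u

Reach : (F : Frame) → ℕ → World F → World F → Set
Reach F k w u = ∃ λ j → j ≤ k × Path F j w u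

Reach-mono : ∀ {F k l w u} → k ≤ l → Reach F k w u → Reach F l w u
Reach-mono k≤l (j , j≤k , path) = j , ≤-trans j≤k k≤l , path

module _ {A : Set} {F : Frame} {V : A → World F → Bool} where

  sat-⋀⁻ : ∀ {w} xs → sat F V w (⋀ xs) ≡ true → All (λ x → sat F V w x ≡ true) xs
  sat-⋀⁻ [] _ = []
  sat-⋀⁻ {w} (x ∷ xs) h = proj₁ (∧-true⁻ h) ∷ sat-⋀⁻ xs (proj₂ (∧-true⁻ {sat F V w x} h))

  sat-⋀⁺ : ∀ {w} xs → All (λ x → sat F V w x ≡ true) xs → sat F V w (⋀ xs) ≡ true
  sat-⋀⁺ [] [] = refl
  sat-⋀⁺ (x ∷ xs) (px ∷ pxs) = ∧-true⁺ px (sat-⋀⁺ xs pxs)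

  sat-⋁⁻ : ∀ {w} xs → sat F V w (⋁ xs) ≡ true → Any (λ x → sat F V w x ≡ true) xs
  sat-⋁⁻ {w} (x ∷ xs) h with sat F V w x in eq
  ... | true = here eq
  ... | false = there (sat-⋁⁻ xs h)

  sat-⋁⁺ : ∀ {w} xs → Any (λ x → sat F V w x ≡ true) xs → sat F V w (⋁ xs) ≡ true
  sat-⋁⁺ (x ∷ xs) (here px) rewrite px = refl
  sat-⋁⁺ {w} (x ∷ xs) (there pxs) rewrite sat-⋁⁺ xs pxs with sat F V w x
  ... | true = refl
  ... | false = refl

  □-true⁻ : ∀ {w u} φ → sat F V w (□ φ) ≡ true → Acc F w u → sat F V u φ ≡ true
  □-true⁻ {w} {u} φ h wRu =
    imp-true⁻ (allB-true⁻ {P = λ u → not (Frame.R F w u) ∨ sat F V u φ} {allFin (size F)} h (∈-allFin u)) wRu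

  □-true⁺ : ∀ {w} φ → (∀ u → Acc F w u → sat F V u φ ≡ true) → sat F V w (□ φ) ≡ true
  □-true⁺ φ h = allB-true⁺ {xs = allFin (size F)} λ u _ → imp-true⁺ (h u)

  □-false⁻ : ∀ {w} φ → sat F V w (□ φ) ≡ false → ∃ λ u → Acc F w u × sat F V u φ ≡ false
  □-false⁻ {w} φ h =
    let u , _ , e = allB-false⁻ {P = λ u → not (Frame.R F w u) ∨ sat F V u φ} {allFin (size F)} h
    in u , imp-false⁻ e

  □^-true⁻ : ∀ {w u} k φ → sat F V w (□^ k φ) ≡ true → Path F k w u → sat F V u φ ≡ true
  □^-true⁻ zero φ h [] = h
  □^-true⁻ (suc k) φ h (wRv ∷ path) = □^-true⁻ k φ (□-true⁻ (□^ k φ) h wRv) path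

  □^-true⁺ : ∀ {w} k φ → (∀ u → Path F k w u → sat F V u φ ≡ true) → sat F V w (□^ k φ) ≡ true
  □^-true⁺ {w} zero φ h = h w []
  □^-true⁺ (suc k) φ h = □-true⁺ (□^ k φ) λ _ wRv → □^-true⁺ k φ λ u path → h u (wRv ∷ path)

  □^-false⁻ : ∀ {w} k φ → sat F V w (□^ k φ) ≡ false → ∃ λ u → Path F k w u × sat F V u φ ≡ false
  □^-false⁻ {w} zero φ h = w , [] , h
  □^-false⁻ (suc k) φ h =
    let _ , wRv , e = □-false⁻ (□^ k φ) h
        u , path , e′ = □^-false⁻ k φ e
    in u , wRv ∷ path , e′

  □≤-true⁻ : ∀ {w u} k φ → sat F V w (□≤ k φ) ≡ true → Reach F k w u → sat F V u φ ≡ true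
  □≤-true⁻ zero φ h (zero , _ , path) = □^-true⁻ zero φ h path
  □≤-true⁻ {w} (suc k) φ h (j , j≤ , path) with m≤n⇒m<n∨m≡n j≤
  ... | inj₁ j<k+1 = □≤-true⁻ k φ (proj₁ (∧-true⁻ h)) (j , s≤s⁻¹ j<k+1 , path)
  ... | inj₂ refl = □^-true⁻ (suc k) φ (proj₂ (∧-true⁻ {sat F V w (□≤ k φ)} h)) path

  □≤-true⁺ : ∀ {w} k φ → (∀ u → Reach F k w u → sat F V u φ ≡ true) → sat F V w (□≤ k φ) ≡ true
  □≤-true⁺ zero φ h = h _ (0 , ≤-refl , [])
  □≤-true⁺ (suc k) φ h =
    ∧-true⁺ (□≤-true⁺ k φ λ u r → h u (Reach-mono (n≤1+n k) r))
            (□^-true⁺ (suc k) φ λ u path → h u (suc k , ≤-refl , path))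

  □≤-false⁻ : ∀ {w} k φ → sat F V w (□≤ k φ) ≡ false → ∃ λ u → Reach F k w u × sat F V u φ ≡ false
  □≤-false⁻ zero φ h = _ , (0 , ≤-refl , []) , h
  □≤-false⁻ {w} (suc k) φ h with ∧-false⁻ {sat F V w (□≤ k φ)} h
  ... | inj₁ e = let u , r , e′ = □≤-false⁻ k φ e in u , Reach-mono (n≤1+n k) r , e′
  ... | inj₂ e = let u , path , e′ = □^-false⁻ (suc k) φ e in u , (suc k , ≤-refl , path) , e′

  ◇≤-true⁻ : ∀ {w} k φ → sat F V w (◇≤ k φ) ≡ true → ∃ λ u → Reach F k w u × sat F V u φ ≡ true
  ◇≤-true⁻ k φ h = let u , r , e = □≤-false⁻ k (¬ₘ φ) (not-true⁻ h) in u , r , not-false⁻ e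

  ◇≤-true⁺ : ∀ {w u} k φ → Reach F k w u → sat F V u φ ≡ true → sat F V w (◇≤ k φ) ≡ true
  ◇≤-true⁺ {w} k φ r φu with sat F V w (□≤ k (¬ₘ φ)) in eq
  ... | false = refl
  ... | true with trans (sym φu) (not-true⁻ (□≤-true⁻ k (¬ₘ φ) eq r))
  ... | ()

-- A walk from the root shortens to one without repeated worlds, which visits at
-- most size F worlds; so every world lies within Frame.n F steps of the root.
data SimplePath (F : Frame) : ℕ → World F → World F → List (World F) → Set where
  done : ∀ {u} → SimplePath F 0 u u (u ∷ [])
  step : ∀ {k w v u vs} → Acc F w v → SimplePath F k v u vs → SimplePath F (suc k) w u (w ∷ vs)

SimplePath⇒Path : ∀ {F k w u vs} → SimplePath F k w u vs → Path F k w u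
SimplePath⇒Path done = []
SimplePath⇒Path (step wRv path) = wRv ∷ SimplePath⇒Path path

SimplePath-length : ∀ {F k w u vs} → SimplePath F k w u vs → length vs ≡ suc k
SimplePath-length done = refl
SimplePath-length (step _ path) = cong suc (SimplePath-length path)

SimplePath-suffix : ∀ {F k v u vs w} → SimplePath F k v u vs → w ∈ vs →
                    ∃₂ λ k′ vs′ → SimplePath F k′ w u vs′ × (Unique vs → Unique vs′)
SimplePath-suffix done (here refl) = _ , _ , done , λ unique → unique
SimplePath-suffix (step wRv path) (here refl) = _ , _ , step wRv path , λ unique → unique
SimplePath-suffix (step _ path) (there w∈) =
  let k′ , vs′ , path′ , shrink = SimplePath-suffix path w∈
  in k′ , vs′ , path′ , λ { (_ ∷ unique) → shrink unique }

Star⇒SimplePath : ∀ {F w u} → Star (Acc F) w u → ∃₂ λ k vs → SimplePath F k w u vs × Unique vs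
Star⇒SimplePath ε = _ , _ , done , ([] ∷ [])
Star⇒SimplePath {w = w} (wRv ◅ walk) with Star⇒SimplePath walk
... | k , vs , path , unique with DecMembership._∈?_ _≟_ w vs
...   | yes w∈ = let k′ , vs′ , path′ , shrink = SimplePath-suffix path w∈ in k′ , vs′ , path′ , shrink unique
...   | no w∉ = suc k , w ∷ vs , step wRv path , (¬Any⇒All¬ vs w∉ ∷ unique)

Unique-lookup-injective : ∀ {A : Set} {xs : List A} → Unique xs → ∀ i j → lookup xs i ≡ lookup xs j → i ≡ j
Unique-lookup-injective (_ ∷ _) zero zero _ = refl
Unique-lookup-injective (x∉ ∷ _) zero (suc j) eq = ⊥-elim (All.lookup x∉ (∈-lookup j) eq)
Unique-lookup-injective (x∉ ∷ _) (suc i) zero eq = ⊥-elim (All.lookup x∉ (∈-lookup i) (sym eq))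
Unique-lookup-injective (_ ∷ unique) (suc i) (suc j) eq = cong suc (Unique-lookup-injective unique i j eq)

Unique-length≤ : ∀ {m} {xs : List (Fin m)} → Unique xs → length xs ≤ m
Unique-length≤ unique = injective⇒≤ λ {i} {j} → Unique-lookup-injective unique i j

Rooted⇒Reach : ∀ {F} → Rooted F → ∀ w → Reach F (Frame.n F) zero w
Rooted⇒Reach {F} rooted w =
  let k , vs , path , unique = Star⇒SimplePath (rooted w)
  in k , s≤s⁻¹ (subst (_≤ size F) (SimplePath-length path) (Unique-length≤ unique)) , SimplePath⇒Path path

size≤maxSize : ∀ {F FL} → F ∈ FL → size F ≤ maxSize FL
size≤maxSize {F} {_ ∷ FL} (here refl) = m≤m⊔n (size F) (maxSize FL)
size≤maxSize {_} {G ∷ _} (there F∈) = m≤n⇒m≤o⊔n (size G) (size≤maxSize F∈)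

Rooted⇒Reach-maxSize : ∀ {F FL} → F ∈ FL → Rooted F → ∀ w → Reach F (maxSize FL) zero w
Rooted⇒Reach-maxSize F∈ rooted w = Reach-mono (≤-trans (n≤1+n _) (size≤maxSize F∈)) (Rooted⇒Reach rooted w)

module Labelling {σ : List ℕ} {Φ : List (PL ℕ)} (eme : IsEME σ Φ) where

  private
    exhaustive : ∀ v → Any (λ φ → evalPL v φ ≡ true) Φ
    exhaustive = proj₁ (proj₂ (proj₂ eme))

    exclusive : ∀ i j → i ≢ j → ∀ v → evalPL v (lookup Φ i) ≡ true → evalPL v (lookup Φ j) ≡ false
    exclusive = proj₂ (proj₂ (proj₂ eme))

  label : (F : Frame) → Valuation F → World F → Fin (length Φ)
  label F V w = Any.index (exhaustive λ p → V p w)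

  module _ {F : Frame} {V : Valuation F} where

    label-true : ∀ w → evalPL (λ p → V p w) (lookup Φ (label F V w)) ≡ true
    label-true w = AnyP.lookup-index (exhaustive λ p → V p w)

    others-false : ∀ w i → label F V w ≢ i → evalPL (λ p → V p w) (lookup Φ i) ≡ false
    others-false w i ne = exclusive (label F V w) i ne (λ p → V p w) (label-true w)

    label-unique : ∀ w i → evalPL (λ p → V p w) (lookup Φ i) ≡ true → label F V w ≡ i
    label-unique w i φᵢ-true with label F V w ≟ i
    ... | yes eq = eq
    ... | no ne with trans (sym (others-false w i ne)) φᵢ-true
    ... | ()

    absVal-label : ∀ i w → absVal F (label F V) i w ≡ sat F V w (embPL (lookup Φ i))
    absVal-label i w rewrite sat-embPL F V w (lookup Φ i) with label F V w ≟ i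
    ... | yes refl = sym (label-true w)
    ... | no ne = sym (others-false w i ne)

    sat-toFm : ∀ w δ → sat F V w (toFm Φ δ) ≡ sat F (absVal F (label F V)) w δ
    sat-toFm w δ = trans (sat-substFm F V (λ i → embPL (lookup Φ i)) w δ)
                         (sat-cong F (λ i u → sym (absVal-label i u)) w δ)

  label-cong : ∀ {F V F′ V′ w w′} → (∀ {p} → p ∈ σ → V p w ≡ V′ p w′) → label F V w ≡ label F′ V′ w′
  label-cong {F} {V} {F′} {V′} {w} {w′} agree = sym (label-unique {F′} {V′} w′ (label F V w)
    (trans (sym (evalPL-cong-on (lookup Φ (label F V w)) (All.lookup (proj₁ eme) (∈-lookup (label F V w)))
                                λ _ p∈ → agree p∈))
           (label-true {F} {V} w)))

  Bisim₀⇒AbsBisim₀ : ∀ {F V F′ V′} → Bisim₀ σ F V F′ V′ →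
                     AbsBisim₀ (absModel F (label F V)) (absModel F′ (label F′ V′))
  Bisim₀⇒AbsBisim₀ {F} {V} {F′} {V′} (Z , bisim , z₀) =
    Z , (λ z → label-cong {F} {V} {F′} {V′} (IsBisim.atoms bisim z)) , IsBisim.forth bisim , IsBisim.back bisim , z₀

cover-true⁺ : ∀ {N σ Φ F V w} → IsCover σ Φ F V → sat F V w (cover N σ Φ) ≡ true
cover-true⁺ {N} {F = F} {V} cov =
  sat-⋀⁺ _ (AllP.map⁺ (All.tabulate λ {φ} φ∈ → sat-⋀⁺ _ (AllP.map⁺ (All.tabulate λ {p} p∈ →
    imp-true⁺ λ φp-somewhere →
      let u , _ , φp-at-u = ◇≤-true⁻ N (embPL φ ∧ₘ atom p) φp-somewhere
          φu , pu = ∧-true⁻ φp-at-u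
      in □≤-true⁺ N (embPL φ ⇒ₘ atom p) λ u′ _ → imp-true⁺ λ φu′ →
           trans (sym (cov φ φ∈ u u′ (trans (sym (sat-embPL F V u φ)) φu)
                                      (trans (sym (sat-embPL F V u′ φ)) φu′) p∈)) pu))))

cover-true⁻ : ∀ {N σ Φ F V} → (∀ w → Reach F N zero w) →
              sat F V zero (cover N σ Φ) ≡ true → IsCover σ Φ F V
cover-true⁻ {N} {F = F} {V} reach h φ φ∈ w u φw φu {p} p∈ = true⇔true⇒≡ (transfer φw φu) (transfer φu φw)
  where
  clause : sat F V zero (◇≤ N (embPL φ ∧ₘ atom p) ⇒ₘ □≤ N (embPL φ ⇒ₘ atom p)) ≡ true
  clause = All.lookup (AllP.map⁻ (sat-⋀⁻ _ (All.lookup (AllP.map⁻ (sat-⋀⁻ _ h)) φ∈))) p∈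
  transfer : ∀ {w u} → evalPL (λ q → V q w) φ ≡ true → evalPL (λ q → V q u) φ ≡ true → V p w ≡ true → V p u ≡ true
  transfer {w} {u} φw φu pw =
    let φp-somewhere = ◇≤-true⁺ N (embPL φ ∧ₘ atom p) (reach w) (∧-true⁺ (trans (sat-embPL F V w φ) φw) pw)
    in imp-true⁻ (□≤-true⁻ N (embPL φ ⇒ₘ atom p) (imp-true⁻ clause φp-somewhere) (reach u))
                 (trans (sat-embPL F V u φ) φu)

AbsBisim₀-sym : ∀ {k} {𝔄 𝔅 : AbsModel k} → AbsBisim₀ 𝔄 𝔅 → AbsBisim₀ 𝔅 𝔄
AbsBisim₀-sym {𝔄 = absModel _ _} {absModel _ _} (Z , same , forth , back , z₀) =
  (λ w w′ → Z w′ w) , (λ z → sym (same z)) , back , forth , z₀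

AbsBisim₀-trans : ∀ {k} {𝔄 𝔅 ℭ : AbsModel k} → AbsBisim₀ 𝔄 𝔅 → AbsBisim₀ 𝔅 ℭ → AbsBisim₀ 𝔄 ℭ
AbsBisim₀-trans {𝔄 = absModel _ _} {absModel _ _} {absModel _ _}
                (Z , same , forth , back , z₀) (Z′ , same′ , forth′ , back′ , z₀′) =
  (λ a c → ∃ λ b → Z a b × Z′ b c) ,
  (λ { (_ , z , z′) → trans (same z) (same′ z′) }) ,
  (λ { (_ , z , z′) aRa′ → let b′ , bRb′ , zb = forth z aRa′ ; c′ , cRc′ , zc = forth′ z′ bRb′
                           in c′ , cRc′ , (b′ , zb , zc) }) ,
  (λ { (_ , z , z′) cRc′ → let b′ , bRb′ , zb = back′ z′ cRc′ ; a′ , aRa′ , za = back z bRb′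
                           in a′ , aRa′ , (b′ , za , zb) }) ,
  (zero , z₀ , z₀′)

IsClassId-determines : ∀ {FL k} {δ : Fm (Fin k)} → IsClassId FL δ → ∀ {𝔅 ℭ} →
                       AbsModel.frm 𝔅 ∈ FL → AbsModel.frm ℭ ∈ FL → satAbs 𝔅 δ ≡ true →
                       (satAbs ℭ δ ≡ true ⇔ AbsBisim₀ 𝔅 ℭ)
IsClassId-determines (𝔄 , _ , identifies) 𝔅∈ ℭ∈ 𝔅⊨δ =
  mk⇔ (λ ℭ⊨δ → AbsBisim₀-trans (AbsBisim₀-sym 𝔄~𝔅) (Equivalence.to (identifies _ ℭ∈) ℭ⊨δ))
      (λ 𝔅~ℭ → Equivalence.from (identifies _ ℭ∈) (AbsBisim₀-trans 𝔄~𝔅 𝔅~ℭ))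
  where 𝔄~𝔅 = Equivalence.to (identifies _ 𝔅∈) 𝔅⊨δ

satAbs-cong : ∀ {k} F {f g : World F → Fin k} → (∀ w → f w ≡ g w) → ∀ δ →
              satAbs (absModel F f) δ ≡ satAbs (absModel F g) δ
satAbs-cong F f≗g = sat-cong F (λ i w → cong (λ j → does (j ≟ i)) (f≗g w)) zero

-- Without function extensionality allFuns contains f only up to pointwise equality.
allFuns-complete : ∀ n k (f : Fin n → Fin k) → Any (λ g → ∀ x → g x ≡ f x) (allFuns n k)
allFuns-complete zero k f = here λ ()
allFuns-complete (suc n) k f =
  AnyP.concat⁺ (AnyP.map⁺ (lose (∈-allFin (f zero))
    (AnyP.map⁺ (Any.map (λ g≗f → λ { zero → refl ; (suc x) → g≗f x })
                        (allFuns-complete n k (λ x → f (suc x)))))))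

module _ {A : Set} {P : A → Set} {Q : A → Bool} where

  Any-boolFilter⁻ : ∀ xs → Any P (boolFilter Q xs) → Any (λ x → Q x ≡ true × P x) xs
  Any-boolFilter⁻ (x ∷ xs) h with Q x in Qx
  ... | true with h
  ...   | here Px = here (Qx , Px)
  ...   | there h′ = there (Any-boolFilter⁻ xs h′)
  Any-boolFilter⁻ (x ∷ xs) h | false = there (Any-boolFilter⁻ xs h)

  Any-boolFilter⁺ : ∀ xs → Any (λ x → Q x ≡ true × P x) xs → Any P (boolFilter Q xs)
  Any-boolFilter⁺ (x ∷ xs) (here (Qx , Px)) rewrite Qx = here Px
  Any-boolFilter⁺ (x ∷ xs) (there h) with Q x
  ... | true = there (Any-boolFilter⁺ xs h)
  ... | false = Any-boolFilter⁺ xs h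

witnessed : ℕ → (Φ : List (PL ℕ)) (F₀ : Frame) → Valuation F₀ → Fin (length Φ) → ℕ → Bool
witnessed N Φ F₀ V i p = sat F₀ V zero (◇≤ N (embPL (lookup Φ i) ∧ₘ atom p))

coverValuation : ℕ → (Φ : List (PL ℕ)) (F₀ : Frame) → Valuation F₀ →
                 (F : Frame) → (World F → Fin (length Φ)) → Valuation F
coverValuation N Φ F₀ V F f p w = witnessed N Φ F₀ V (f w) p

sat-xiF : ∀ N Φ F₀ V F f ξ →
          sat F₀ V zero (xiF N Φ F f ξ) ≡ evalPL (λ pw → coverValuation N Φ F₀ V F f (proj₁ pw) (proj₂ pw)) ξ
sat-xiF N Φ F₀ V F f ξ = trans (sat-substFm F₀ V _ zero (embPL ξ)) (sat-embPL F₀ _ zero ξ)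

IsBisim-back-Star : ∀ {σ F V F′ V′ Z} → IsBisim σ F V F′ V′ Z →
                    ∀ {w w′ u′} → Z w w′ → Star (Acc F′) w′ u′ → ∃ λ u → Z u u′
IsBisim-back-Star bisim z ε = _ , z
IsBisim-back-Star bisim z (w′Rv′ ◅ walk) = IsBisim-back-Star bisim (proj₂ (proj₂ (IsBisim.back bisim z w′Rv′))) walk

module CoverReading {σ Φ} (eme : IsEME σ Φ) {N F₀} {V : Valuation F₀}
                    (cov : IsCover σ Φ F₀ V) (reach : ∀ w → Reach F₀ N zero w) where

  open Labelling eme

  atom-by-cover : ∀ w {p} → p ∈ σ → V p w ≡ witnessed N Φ F₀ V (label F₀ V w) p
  atom-by-cover w {p} p∈ = true⇔true⇒≡
    (λ pw → ◇≤-true⁺ N (embPL φ ∧ₘ atom p) (reach w) (∧-true⁺ (trans (sat-embPL F₀ V w φ) φ-at-w) pw))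
    (λ φp-somewhere →
      let u , _ , φp-at-u = ◇≤-true⁻ N (embPL φ ∧ₘ atom p) φp-somewhere
          φu , pu = ∧-true⁻ φp-at-u
      in trans (cov φ (∈-lookup i) w u φ-at-w (trans (sym (sat-embPL F₀ V u φ)) φu) p∈) pu)
    where
    i : Fin (length Φ)
    i = label F₀ V w
    φ : PL ℕ
    φ = lookup Φ i
    φ-at-w : evalPL (λ q → V q w) φ ≡ true
    φ-at-w = label-true {F₀} {V} w

  AbsBisim₀⇒Bisim₀ : ∀ {F f} → AbsBisim₀ (absModel F₀ (label F₀ V)) (absModel F f) →
                     Bisim₀ σ F₀ V F (coverValuation N Φ F₀ V F f)
  AbsBisim₀⇒Bisim₀ (Z , same , forth , back , z₀) =
    Z , record { atoms = λ {w} z {p} p∈ → trans (atom-by-cover w p∈) (cong (λ i → witnessed N Φ F₀ V i p) (same z))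
               ; forth = forth ; back = back } , z₀

  Bisim₀⇒≡coverValuation : ∀ {F V′} → Rooted F → Bisim₀ σ F₀ V F V′ →
                           ∀ w′ {p} → p ∈ σ → V′ p w′ ≡ coverValuation N Φ F₀ V F (label F V′) p w′
  Bisim₀⇒≡coverValuation {F} {V′} rooted (_ , bisim , z₀) w′ {p} p∈ =
    let w , z = IsBisim-back-Star bisim z₀ (rooted w′)
    in trans (sym (IsBisim.atoms bisim z p∈))
             (trans (atom-by-cover w p∈)
                    (cong (λ i → witnessed N Φ F₀ V i p) (label-cong {F₀} {V} {F} {V′} (IsBisim.atoms bisim z))))

ξ-disjunction : ℕ → (Φ : List (PL ℕ)) (F : Frame) → Fm (Fin (length Φ)) → PL (ℕ × World F) → Fm ℕ
ξ-disjunction N Φ F δ ξ =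
  ⋁ (map (λ f → xiF N Φ F f ξ) (boolFilter (λ f → satAbs (absModel F f) δ) (allFuns (size F) (length Φ))))

sat-rt : ∀ FL σ enc F ξ F₀ V w →
         sat F₀ V w (rt FL σ enc F ξ) ≡ true ⇔
         (∀ {Φ Δ} → (Φ , Δ) ∈ enc → ∀ {δ} → δ ∈ Δ →
            sat F₀ V w (cover (maxSize FL) σ Φ ∧ₘ toFm Φ δ) ≡ true →
            sat F₀ V w (ξ-disjunction (maxSize FL) Φ F δ ξ) ≡ true)
sat-rt FL σ enc F ξ F₀ V w = mk⇔
  (λ h {_} {_} ΦΔ∈ {_} δ∈ →
     imp-true⁻ (All.lookup (AllP.map⁻ (All.lookup (AllP.map⁻ (AllP.concat⁻ (sat-⋀⁻ _ h))) ΦΔ∈)) δ∈))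
  (λ h → sat-⋀⁺ _ (AllP.concat⁺ (AllP.map⁺ (All.tabulate λ ΦΔ∈ →
                                 AllP.map⁺ (All.tabulate λ δ∈ → imp-true⁺ (h ΦΔ∈ δ∈))))))

sat-ξ-disjunction : ∀ N Φ F₀ V F δ ξ →
                    sat F₀ V zero (ξ-disjunction N Φ F δ ξ) ≡ true ⇔
                    ∃ λ f → satAbs (absModel F f) δ ≡ true ×
                            evalPL (λ pw → coverValuation N Φ F₀ V F f (proj₁ pw) (proj₂ pw)) ξ ≡ true
sat-ξ-disjunction N Φ F₀ V F δ ξ = mk⇔
  (λ h → let f , f⊨δ , ξ^f = Any.satisfied (Any-boolFilter⁻ labellings (AnyP.map⁻ (sat-⋁⁻ disjuncts h)))
         in f , f⊨δ , trans (sym (sat-xiF N Φ F₀ V F f ξ)) ξ^f)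
  (λ (f , f⊨δ , ξ-true) → sat-⋁⁺ disjuncts (AnyP.map⁺ (Any-boolFilter⁺ labellings (Any.map
    (λ {g} g≗f → trans (satAbs-cong F g≗f δ) f⊨δ ,
                 trans (sat-xiF N Φ F₀ V F g ξ)
                       (trans (evalPL-cong ξ λ (p , w) → cong (λ i → witnessed N Φ F₀ V i p) (g≗f w)) ξ-true))
    (allFuns-complete _ _ f)))))
  where
  labellings : List (World F → Fin (length Φ))
  labellings = allFuns (size F) (length Φ)
  disjuncts : List (Fm ℕ)
  disjuncts = map (λ f → xiF N Φ F f ξ) (boolFilter (λ f → satAbs (absModel F f) δ) labellings)

module _ {FL : List Frame} (rooted : All Rooted FL) {σ enc} (encoding : IsEncoding FL σ enc)
         {F₀ : Frame} (F₀∈ : F₀ ∈ FL) (V : Valuation F₀) {F : Frame} (F∈ : F ∈ FL) (ξ : PL (ℕ × World F)) where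

  private
    N : ℕ
    N = maxSize FL

    reach : ∀ w → Reach F₀ N zero w
    reach = Rooted⇒Reach-maxSize F₀∈ (All.lookup rooted F₀∈)

  rt⇒bisimilar-model : sat F₀ V zero (rt FL σ enc F ξ) ≡ true →
                       Σ (Valuation F) λ V′ → Bisim₀ σ F₀ V F V′ × evalPL (λ pw → V′ (proj₁ pw) (proj₂ pw)) ξ ≡ true
  rt⇒bisimilar-model h =
    let (Φ , _) , ΦΔ∈ , cov , some-δ = find (proj₂ encoding F₀ F₀∈ V)
        δ , δ∈ , 𝔐⊨δ = find some-δ
        eme , identifiers = All.lookup (proj₁ encoding) ΦΔ∈
        open Labelling eme
        f , f⊨δ , ξ-true = Equivalence.to (sat-ξ-disjunction N Φ F₀ V F δ ξ)
                             (Equivalence.to (sat-rt FL σ enc F ξ F₀ V zero) h ΦΔ∈ δ∈ (∧-true⁺ (cover-true⁺ cov) 𝔐⊨δ))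
        label⊨δ = trans (sym (sat-toFm zero δ)) 𝔐⊨δ
        label~f = Equivalence.to (IsClassId-determines {δ = δ} (All.lookup identifiers δ∈) F₀∈ F∈ label⊨δ) f⊨δ
    in coverValuation N Φ F₀ V F f , CoverReading.AbsBisim₀⇒Bisim₀ eme cov reach label~f , ξ-true

  bisimilar-model⇒rt : AtomsPL (λ pw → proj₁ pw ∈ σ) ξ →
                       Σ (Valuation F) (λ V′ → Bisim₀ σ F₀ V F V′ × evalPL (λ pw → V′ (proj₁ pw) (proj₂ pw)) ξ ≡ true) →
                       sat F₀ V zero (rt FL σ enc F ξ) ≡ true
  bisimilar-model⇒rt ξ-σ (V′ , bisim , ξ-true) =
    Equivalence.from (sat-rt FL σ enc F ξ F₀ V zero) λ {Φ} ΦΔ∈ {δ} δ∈ hyp →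
      let eme , identifiers = All.lookup (proj₁ encoding) ΦΔ∈
          open Labelling eme
          cover-true , 𝔐⊨δ = ∧-true⁻ {sat F₀ V zero (cover N σ Φ)} hyp
          cov = cover-true⁻ reach cover-true
          label⊨δ = trans (sym (sat-toFm zero δ)) 𝔐⊨δ
          label′⊨δ = Equivalence.from (IsClassId-determines {δ = δ} (All.lookup identifiers δ∈) F₀∈ F∈ label⊨δ)
                                      (Bisim₀⇒AbsBisim₀ bisim)
          V′≡ = CoverReading.Bisim₀⇒≡coverValuation eme cov reach (All.lookup rooted F∈) bisim
      in Equivalence.from (sat-ξ-disjunction N Φ F₀ V F δ ξ)
           (label F V′ , label′⊨δ , trans (sym (evalPL-cong-on ξ ξ-σ λ (_ , w′) p∈ → V′≡ w′ p∈)) ξ-true)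

proposition4p7 :
    (FL : List Frame) → All Rooted FL →
    (σ : List ℕ) → (enc : Encoding) → IsEncoding FL σ enc →
    (F₀ : Frame) → F₀ ∈ FL → (V : Valuation F₀) →
    (F : Frame) → F ∈ FL →
    (ξ : PL (ℕ × World F)) → AtomsPL (λ pw → proj₁ pw ∈ σ) ξ →
    (sat F₀ V zero (rt FL σ enc F ξ) ≡ true
      ⇔ Σ (Valuation F) λ V' →
          Bisim₀ σ F₀ V F V' × evalPL (λ pw → V' (proj₁ pw) (proj₂ pw)) ξ ≡ true)
proposition4p7 FL rooted σ enc encoding F₀ F₀∈ V F F∈ ξ ξ-σ =
  mk⇔ (rt⇒bisimilar-model rooted encoding F₀∈ V F∈ ξ)
      (bisimilar-model⇒rt rooted encoding F₀∈ V F∈ ξ ξ-σ)
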